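{- Let $K$ be a field and $T\in K^{n\times n\times p}$ with slices $T_1,\ldots,T_p$. Assume $A\in\langle T_1,\ldots,T_p\rangle$ is invertible and the tuple $(A^{ -1}T_1,\ldots,A^{ -1}T_p)$ admits a commuting extension $(Z_1,\ldots,Z_p)$ by diagonalizable $r\times r$ matrices. Fix any decomposition $T'=\sum_{i=1}^r u'_i\otimes v'_i\otimes w_i$ (with $u'_i,v'_i\in K^r$, $w_i\in K^p$) of the tensor $T'$ with slices $Z_1,\ldots,Z_p$. Let $V\in M_{r,n}(K)$ have as $i$-th row the first $n$ coordinates of $v'_i$, let $U'\in M_{r,n}(K)$ have as $i$-th row the first $n$ coordinates of $u'_i$, and let $U=U'A^T$. Then $T=\sum_{i=1}^r u_i\otimes v_i\otimes w_i$, where $u_1,\ldots,u_r$ are the rows of $U$ and $v_1,\ldots,v_r$ the rows of $V$.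
   Context: $u\otimes v\otimes w$ has entries $u_iv_jw_k$; slices $T_k=(T_{ijk})_{i,j}$. A commuting extension of size $r$ of a tuple of $n\times n$ matrices $(B_1,\ldots,B_p)$ is a tuple of pairwise commuting $r\times r$ matrices $Z_i$ whose top-left $n\times n$ block is $B_i$. -}

module Defs where

open import Level using (_⊔_)
open import Algebra.Bundles using (CommutativeRing)
open import Data.Nat.Base using (ℕ; zero; suc; _≤_)
open import Data.Fin.Base using (Fin; inject≤)

open import Data.Product using (Σ; ∃; _×_; _,_)
open import Relation.Nullary using (¬_; yes; no)
open import Data.Fin.Properties using (_≟_)
open import Relation.Binary.PropositionalEquality using (_≡_)

record Field (c ℓ : Level.Level) : Set (Level.suc (c ⊔ ℓ)) where
  field
    commutativeRing : CommutativeRing c ℓ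
  open CommutativeRing commutativeRing public
  field
    0≉1     : ¬ (0# ≈ 1#)
    inverse : ∀ x → ¬ (x ≈ 0#) → ∃ λ y → x * y ≈ 1#

module LinAlg {c ℓ : Level.Level} (R : CommutativeRing c ℓ) where
  open CommutativeRing R using (_≈_; _+_; _*_; 0#; 1#) renaming (Carrier to K)

  ∑ : (n : ℕ) → (Fin n → K) → K
  ∑ zero    f = 0#
  ∑ (suc n) f = f Fin.zero + ∑ n (λ i → f (Fin.suc i))

  Mat : ℕ → ℕ → Set c
  Mat m n = Fin m → Fin n → K

  _≈M_ : ∀ {m n} → Mat m n → Mat m n → Set ℓ
  A ≈M B = ∀ i j → A i j ≈ B i j

  _⊛_ : ∀ {m n q} → Mat m n → Mat n q → Mat m q
  _⊛_ {n = n} A B i j = ∑ n (λ l → A i l * B l j)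

  I : ∀ {n} → Mat n n
  I i j with i ≟ j
  ... | yes _ = 1#
  ... | no  _ = 0#

  transpose : ∀ {m n} → Mat m n → Mat n m
  transpose A i j = A j i

  IsInverse : ∀ {n} → Mat n n → Mat n n → Set ℓ
  IsInverse A B = (A ⊛ B) ≈M I × (B ⊛ A) ≈M I

  Invertible : ∀ {n} → Mat n n → Set (c ⊔ ℓ)
  Invertible {n} A = Σ (Mat n n) (IsInverse A)

  Diagonal : ∀ {n} → Mat n n → Set ℓ
  Diagonal D = ∀ i j → ¬ (i ≡ j) → D i j ≈ 0#

  Diagonalizable : ∀ {n} → Mat n n → Set (c ⊔ ℓ)
  Diagonalizable {n} Z =
    Σ (Mat n n) λ P → Σ (Mat n n) λ Q → IsInverse P Q × Diagonal ((Q ⊛ Z) ⊛ P)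

  Tensor : ℕ → ℕ → ℕ → Set c
  Tensor n m p = Fin n → Fin m → Fin p → K

  slice : ∀ {n m p} → Tensor n m p → Fin p → Mat n m
  slice T k i j = T i j k

  ofSlices : ∀ {n m p} → (Fin p → Mat n m) → Tensor n m p
  ofSlices Z i j k = Z k i j

  _≈T_ : ∀ {n m p} → Tensor n m p → Tensor n m p → Set ℓ
  S ≈T T = ∀ i j k → S i j k ≈ T i j k

  -- ∑_{l<r} u_l ⊗ v_l ⊗ w_l, where u, v, w are given as matrices whose
  -- l-th row is u_l, v_l, w_l respectively
  decomp : ∀ {r n m p} → Mat r n → Mat r m → Mat r p → Tensor n m p
  decomp {r} u v w i j k = ∑ r (λ l → (u l i * v l j) * w l k)

  InSpan : ∀ {n m p} → Mat n m → (Fin p → Mat n m) → Set (c ⊔ ℓ)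
  InSpan {p = p} A B = Σ (Fin p → K) λ coef → ∀ i j → A i j ≈ ∑ p (λ k → coef k * B k i j)

  Commuting : ∀ {p r} → (Fin p → Mat r r) → Set ℓ
  Commuting Z = ∀ k l → (Z k ⊛ Z l) ≈M (Z l ⊛ Z k)

  topLeft : ∀ {n r} → .(n ≤ r) → Mat r r → Mat n n
  topLeft le Z i j = Z (inject≤ i le) (inject≤ j le)

  IsCommutingExtension : ∀ {p n r} → .(n ≤ r) → (Fin p → Mat r r) → (Fin p → Mat n n) → Set ℓ
  IsCommutingExtension le Z B = Commuting Z × (∀ k → topLeft le (Z k) ≈M B k)

  firstCols : ∀ {r q n} → .(n ≤ q) → Mat r q → Mat r n
  firstCols le M l j = M l (inject≤ j le)

{-# OPTIONS --safe #-}
-- Since A A⁻¹ = I, each slice satisfies T_k = A (A⁻¹ T_k).  The matrix A⁻¹ T_k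
-- is the top-left block of Z_k, and restricting T′ = ∑ u′_l ⊗ v′_l ⊗ w_l to
-- that block gives A⁻¹ T_k = ∑_l w_lk U′_l V_lᵀ (U′_l, V_l the truncated
-- vectors).  Multiplying on the left by A turns U′_l into A U′_l, the l-th
-- row of U′ Aᵀ.
module Submission where

open import Defs
open import Level using (Level)
open import Data.Nat.Base using (ℕ; _≤_; zero; suc)
open import Data.Fin.Base using (Fin; inject≤)
open import Data.Fin.Properties using (_≟_)
open import Data.Product using (_,_)
open import Algebra.Bundles using (CommutativeRing)
import Algebra.Properties.Semiring.Sum as SemiringSum
import Algebra.Solver.CommutativeMonoid as CommutativeMonoidSolver
open import Relation.Binary.PropositionalEquality as ≡ using (_≡_)
import Relation.Binary.Reasoning.Setoid as SetoidReasoning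
open import Relation.Nullary using (yes; no)

module MatrixProperties {c ℓ : Level} (R : CommutativeRing c ℓ) where
  open CommutativeRing R renaming (Carrier to K)
  open LinAlg R
  open SemiringSum semiring using (sum; sum-cong-≋; sum-replicate-zero; *-distribˡ-sum; *-distribʳ-sum)
    renaming (∑-comm to sum-comm)
  open SetoidReasoning setoid

  ∑≡sum : ∀ n (f : Fin n → K) → ∑ n f ≡ sum f
  ∑≡sum zero    f = ≡.refl
  ∑≡sum (suc n) f = ≡.cong (f Fin.zero +_) (∑≡sum n (λ i → f (Fin.suc i)))

  ∑-cong : ∀ n {f g : Fin n → K} → (∀ i → f i ≈ g i) → ∑ n f ≈ ∑ n g
  ∑-cong n {f} {g} f≈g = begin
    ∑ n f  ≡⟨ ∑≡sum n f ⟩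
    sum f  ≈⟨ sum-cong-≋ f≈g ⟩
    sum g  ≡⟨ ∑≡sum n g ⟨
    ∑ n g  ∎

  *-distribˡ-∑ : ∀ n x (f : Fin n → K) → x * ∑ n f ≈ ∑ n (λ i → x * f i)
  *-distribˡ-∑ n x f = begin
    x * ∑ n f                ≡⟨ ≡.cong (x *_) (∑≡sum n f) ⟩
    x * sum f                ≈⟨ *-distribˡ-sum x f ⟩
    sum (λ i → x * f i)      ≡⟨ ∑≡sum n _ ⟨
    ∑ n (λ i → x * f i)      ∎

  *-distribʳ-∑ : ∀ n x (f : Fin n → K) → ∑ n f * x ≈ ∑ n (λ i → f i * x)
  *-distribʳ-∑ n x f = begin
    ∑ n f * x                ≡⟨ ≡.cong (_* x) (∑≡sum n f) ⟩
    sum f * x                ≈⟨ *-distribʳ-sum x f ⟩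
    sum (λ i → f i * x)      ≡⟨ ∑≡sum n _ ⟨
    ∑ n (λ i → f i * x)      ∎

  ∑-comm : ∀ m n (f : Fin m → Fin n → K) →
           ∑ m (λ i → ∑ n (f i)) ≈ ∑ n (λ j → ∑ m (λ i → f i j))
  ∑-comm m n f = begin
    ∑ m (λ i → ∑ n (f i))              ≈⟨ ∑-cong m (λ i → reflexive (∑≡sum n (f i))) ⟩
    ∑ m (λ i → sum (f i))              ≡⟨ ∑≡sum m _ ⟩
    sum (λ i → sum (f i))              ≈⟨ sum-comm f ⟩
    sum (λ j → sum (λ i → f i j))      ≡⟨ ∑≡sum n _ ⟨
    ∑ n (λ j → sum (λ i → f i j))      ≈⟨ ∑-cong n (λ j → reflexive (∑≡sum m (λ i → f i j))) ⟨
    ∑ n (λ j → ∑ m (λ i → f i j))      ∎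

  I-suc : ∀ {n} (i j : Fin n) → I {suc n} (Fin.suc i) (Fin.suc j) ≡ I i j
  I-suc i j with i ≟ j
  ... | yes _ = ≡.refl
  ... | no  _ = ≡.refl

  ∑[I*f]≈f : ∀ n (i : Fin n) (f : Fin n → K) → ∑ n (λ l → I i l * f l) ≈ f i
  ∑[I*f]≈f (suc n) Fin.zero f = begin
    1# * f Fin.zero + ∑ n (λ l → 0# * f (Fin.suc l))
      ≈⟨ +-cong (*-identityˡ _) (∑-cong n (λ l → zeroˡ _)) ⟩
    f Fin.zero + ∑ n (λ _ → 0#)      ≈⟨ +-congˡ (reflexive (∑≡sum n _)) ⟩
    f Fin.zero + sum {n} (λ _ → 0#)  ≈⟨ +-congˡ (sum-replicate-zero n) ⟩
    f Fin.zero + 0#                  ≈⟨ +-identityʳ _ ⟩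
    f Fin.zero                       ∎
  ∑[I*f]≈f (suc n) (Fin.suc i) f = begin
    0# * f Fin.zero + ∑ n (λ l → I (Fin.suc i) (Fin.suc l) * f (Fin.suc l))
      ≈⟨ +-cong (zeroˡ _) (∑-cong n (λ l → reflexive (≡.cong (_* f (Fin.suc l)) (I-suc i l)))) ⟩
    0# + ∑ n (λ l → I i l * f (Fin.suc l))  ≈⟨ +-identityˡ _ ⟩
    ∑ n (λ l → I i l * f (Fin.suc l))       ≈⟨ ∑[I*f]≈f n i _ ⟩
    f (Fin.suc i)                           ∎

  ⊛-identityˡ : ∀ {m n} (B : Mat m n) → (I ⊛ B) ≈M B
  ⊛-identityˡ {m} B i j = ∑[I*f]≈f m i (λ l → B l j)

  ⊛-congˡ : ∀ {m n q} (A : Mat m n) {B C : Mat n q} → B ≈M C → (A ⊛ B) ≈M (A ⊛ C)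
  ⊛-congˡ {n = n} A B≈C i j = ∑-cong n (λ l → *-congˡ (B≈C l j))

  ⊛-congʳ : ∀ {m n q} {A B : Mat m n} (C : Mat n q) → A ≈M B → (A ⊛ C) ≈M (B ⊛ C)
  ⊛-congʳ {n = n} C A≈B i j = ∑-cong n (λ l → *-congʳ (A≈B i l))

  ⊛-assoc : ∀ {m n q s} (A : Mat m n) (B : Mat n q) (C : Mat q s) →
            ((A ⊛ B) ⊛ C) ≈M (A ⊛ (B ⊛ C))
  ⊛-assoc {n = n} {q} A B C i j = begin
    ∑ q (λ l → ∑ n (λ a → A i a * B a l) * C l j)      ≈⟨ ∑-cong q (λ l → *-distribʳ-∑ n _ _) ⟩
    ∑ q (λ l → ∑ n (λ a → (A i a * B a l) * C l j))    ≈⟨ ∑-comm n q _ ⟨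
    ∑ n (λ a → ∑ q (λ l → (A i a * B a l) * C l j))    ≈⟨ ∑-cong n (λ a → ∑-cong q (λ l → *-assoc _ _ _)) ⟩
    ∑ n (λ a → ∑ q (λ l → A i a * (B a l * C l j)))    ≈⟨ ∑-cong n (λ a → *-distribˡ-∑ q _ _) ⟨
    ∑ n (λ a → A i a * ∑ q (λ l → B a l * C l j))      ∎

  A⊛[B⊛M]≈M : ∀ {n q} {A B : Mat n n} → (A ⊛ B) ≈M I → (M : Mat n q) → (A ⊛ (B ⊛ M)) ≈M M
  A⊛[B⊛M]≈M {A = A} {B} A⊛B≈I M i j = begin
    (A ⊛ (B ⊛ M)) i j  ≈⟨ ⊛-assoc A B M i j ⟨
    ((A ⊛ B) ⊛ M) i j  ≈⟨ ⊛-congʳ M A⊛B≈I i j ⟩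
    (I ⊛ M) i j        ≈⟨ ⊛-identityˡ M i j ⟩
    M i j              ∎

  ⊛-slice-decomp : ∀ {m n q r p} (M : Mat m n) (u : Mat r n) (v : Mat r q) (w : Mat r p) k →
                   (M ⊛ slice (decomp u v w) k) ≈M slice (decomp (u ⊛ transpose M) v w) k
  ⊛-slice-decomp {n = n} {r = r} M u v w k i j = begin
    ∑ n (λ a → M i a * ∑ r (λ l → (u l a * v l j) * w l k))      ≈⟨ ∑-cong n (λ a → *-distribˡ-∑ r _ _) ⟩
    ∑ n (λ a → ∑ r (λ l → M i a * ((u l a * v l j) * w l k)))    ≈⟨ ∑-comm n r _ ⟩
    ∑ r (λ l → ∑ n (λ a → M i a * ((u l a * v l j) * w l k)))    ≈⟨ ∑-cong r (λ l → ∑-cong n (λ a → shuffle _ _ _ _)) ⟩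
    ∑ r (λ l → ∑ n (λ a → ((u l a * M i a) * v l j) * w l k))    ≈⟨ ∑-cong r (λ l → *-distribʳ-∑ n _ _) ⟨
    ∑ r (λ l → ∑ n (λ a → (u l a * M i a) * v l j) * w l k)      ≈⟨ ∑-cong r (λ l → *-congʳ (*-distribʳ-∑ n _ _)) ⟨
    ∑ r (λ l → (∑ n (λ a → u l a * M i a) * v l j) * w l k)      ∎
    where
    open CommutativeMonoidSolver *-commutativeMonoid using (solve; _⊕_; _⊜_)
    shuffle : ∀ x a b d → x * ((a * b) * d) ≈ ((a * x) * b) * d
    shuffle = solve 4 (λ x a b d → x ⊕ ((a ⊕ b) ⊕ d) ⊜ ((a ⊕ x) ⊕ b) ⊕ d) refl

  restrict-decomp : ∀ {p n r} (le : n ≤ r) {Z : Fin p → Mat r r} {B : Fin p → Mat n n}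
                    {u v : Mat r r} {w : Mat r p} →
                    (∀ k → topLeft le (Z k) ≈M B k) → ofSlices Z ≈T decomp u v w →
                    ofSlices B ≈T decomp (firstCols le u) (firstCols le v) w
  restrict-decomp le Z-extends-B Z≈decomp i j k =
    trans (sym (Z-extends-B k i j)) (Z≈decomp (inject≤ i le) (inject≤ j le) k)

corollary3p5 : ∀ {c ℓ : Level} (F : Field c ℓ) →
    let open Field F
        open LinAlg commutativeRing
    in (n p r : ℕ) (T : Tensor n n p) (A : Mat n n) →
       InSpan A (slice T) →
       (Ainv : Mat n n) → IsInverse A Ainv →
       (le : n ≤ r) (Z : Fin p → Mat r r) →
       IsCommutingExtension le Z (λ k → Ainv ⊛ slice T k) →
       (∀ k → Diagonalizable (Z k)) →
       (u′ v′ : Mat r r) (w : Mat r p) →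
       ofSlices Z ≈T decomp u′ v′ w →
       let V = firstCols le v′
           U′ = firstCols le u′
           U = U′ ⊛ transpose A
       in T ≈T decomp U V w
corollary3p5 F n p r T A _ Ainv (A⊛Ainv≈I , _) le Z (_ , Z-extends) _ u′ v′ w Z≈decomp i j k =
  begin
    T i j k                                 ≈⟨ A⊛[B⊛M]≈M A⊛Ainv≈I (slice T k) i j ⟨
    (A ⊛ (Ainv ⊛ slice T k)) i j            ≈⟨ ⊛-congˡ A Ainv⊛Tₖ≈decomp i j ⟩
    (A ⊛ slice (decomp U′ V w) k) i j       ≈⟨ ⊛-slice-decomp A U′ V w k i j ⟩
    decomp (U′ ⊛ transpose A) V w i j k     ∎
  where
  open Field F
  open LinAlg commutativeRing
  open MatrixProperties commutativeRing
  open SetoidReasoning setoid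
  U′ = firstCols le u′
  V  = firstCols le v′
  Ainv⊛Tₖ≈decomp : (Ainv ⊛ slice T k) ≈M slice (decomp U′ V w) k
  Ainv⊛Tₖ≈decomp i′ j′ = restrict-decomp le Z-extends Z≈decomp i′ j′ k
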